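{- If $n$ and $d$ are positive integers such that $d\ge 4$ and $d\le n/2$, then $\gamma^{ID}(C_n(1,d-1,d))>\frac n4$.
   Context: All graphs are simple and undirected. For a graph $G=(V,E)$ and $u\in V$, $N[u]=\{u\}\cup\{v: uv\in E\}$. A code is a nonempty $C\subseteq V$, and $I(C;u)=N[u]\cap C$. $C$ is identifying if $I(C;u)\neq\emptyset$ for all $u\in V$ and $I(C;u)\neq I(C;v)$ for all distinct $u,v\in V$. $\gamma^{ID}(G)$ is the minimum cardinality of an identifying code in a finite graph $G$. For positive integers $n$ and $d_1,\dots,d_k\le n/2$, the circulant graph $C_n(d_1,\dots,d_k)$ has vertex set $\mathbb{Z}_n$, and the open neighbourhood of $u$ is $\{u\pm d_1,\dots,u\pm d_k\}$ modulo $n$. -}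

module Defs where

open import Data.Nat using (ℕ; _+_; _%_; NonZero)
open import Data.Nat.Properties using (_≟_)
open import Data.Bool using (Bool; _∨_)
open import Data.List using (List)
open import Data.Bool.ListAction using (any)
open import Data.Fin using (Fin; toℕ)
open import Data.Fin.Subset using (Subset; _∩_; Nonempty)
open import Data.Vec using (tabulate)
open import Data.Product using (_×_)
open import Relation.Nullary using (¬_)
open import Relation.Nullary.Decidable using (⌊_⌋)
open import Relation.Binary.PropositionalEquality using (_≡_)

-- v is u + d or u - d modulo n, i.e. (u + d) mod n = v or (v + d) mod n = u
isDiffNeighbour : (n : ℕ) → .{{NonZero n}} → ℕ → Fin n → Fin n → Bool
isDiffNeighbour n d u v =
  ⌊ ((toℕ u + d) % n) ≟ toℕ v ⌋ ∨ ⌊ ((toℕ v + d) % n) ≟ toℕ u ⌋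

-- closed neighbourhood N[u] in the circulant graph C_n(ds) on vertex set Z_n = Fin n
closedNbhd : (n : ℕ) → .{{NonZero n}} → List ℕ → Fin n → Subset n
closedNbhd n ds u =
  tabulate (λ v → ⌊ toℕ u ≟ toℕ v ⌋ ∨ any (λ d → isDiffNeighbour n d u v) ds)

I : (n : ℕ) → .{{NonZero n}} → List ℕ → Subset n → Fin n → Subset n
I n ds C u = closedNbhd n ds u ∩ C

IsIdentifyingCode : (n : ℕ) → .{{NonZero n}} → List ℕ → Subset n → Set
IsIdentifyingCode n ds C =
  Nonempty C ×
  ((u : Fin n) → Nonempty (I n ds C u)) ×
  ((u v : Fin n) → ¬ (u ≡ v) → ¬ (I n ds C u ≡ I n ds C v))

-- Suppose 4 ∣ C ∣ ≤ n.  Closed neighbourhoods have at most 7 vertices, so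
-- Σᵤ ∣ I(u) ∣ ≤ 7 ∣ C ∣, and at most ∣ C ∣ vertices u have a singleton I(u), one per
-- codeword.  Hence Σᵤ (∣ I(u) ∣ + [∣ I(u) ∣ = 1]) ≤ 8 ∣ C ∣ ≤ 2n, while every summand is at
-- least 2 since I(u) is nonempty; so no summand exceeds 2, that is, ∣ I(u) ∣ ≤ 2 for all u.
-- Then two vertices whose identifying sets share two codewords are equal; in particular
-- no two codewords are adjacent.  For a codeword c this rules out c + 1 + d and
-- c + 1 − e (where e = d − 1) as codewords, and if c + 2 were not a codeword either,
-- I(c) = I(c + 1) = {c}.  So C is closed under adding 2, and as one of e and d is even,
-- c has an adjacent codeword: a contradiction.
module Submission where

open import Defs
open import Data.Nat using (ℕ; _+_; _*_; _∸_; _≤_; _<_; NonZero)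
open import Data.List using (_∷_; [])
open import Data.Fin.Subset using (Subset; ∣_∣)

open import Data.Bool using (Bool; true; false; T; _∨_) renaming (_≟_ to _≟ᵇ_)
open import Data.Bool.Properties using (T-≡; T-∨)
open import Data.Bool.ListAction using (any)
open import Data.Empty using (⊥-elim)
open import Data.Fin using (Fin; zero; suc; toℕ)
open import Data.Fin.Properties using (toℕ-injective; toℕ-fromℕ<; toℕ<n) renaming (_≟_ to _≟ᶠ_)
open import Data.Fin.Subset using (_∈_; _∉_; _⊆_; _∩_; ⁅_⁆; Nonempty; Empty; inside; outside)
open import Data.Fin.Subset.Properties
  using (_∈?_; nonempty?; Empty-unique; ∣⊥∣≡0; ∣⁅x⁆∣≡1; x∈⁅x⁆; x∈⁅y⁆⇒x≡y; p⊆q⇒∣p∣≤∣q∣;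
         x∈p⇒∣p-x∣<∣p∣; x∈p∧x≢y⇒x∈p-y; ⊆-antisym; drop-there; x∈p∩q⁺; x∈p∩q⁻)
open import Data.List using (List; length)
open import Data.List.Membership.Propositional using () renaming (_∈_ to _∈ₗ_)
open import Data.List.Relation.Unary.Any using (Any; here; there)
import Data.List.Relation.Unary.Any as Any
open import Data.List.Relation.Unary.Any.Properties using (any⁺; any⁻)
open import Data.Nat using (zero; suc; z≤n; s≤s; _%_; _/_; _≤?_)
open import Data.Nat.DivMod
  using (_mod_; m%n<n; m%n≤n; %-distribˡ-+; m%n%n≡m%n; %-remove-+ʳ; m<n⇒m%n≡m; m≡m%n+[m/n]*n)
open import Data.Nat.Divisibility using (_∣_; ∣-refl; _∣0)
open import Data.Nat.Properties
  using (+-0-commutativeMonoid; ≤-trans; ≤-reflexive; ≰⇒>; <⇒≱; <⇒≢;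
         +-mono-≤; +-monoʳ-≤; +-monoˡ-≤; +-monoʳ-<; +-mono-<-≤; +-mono-≤-<; m≤m+n; m≤n+m; n≤1+n;
         +-suc; +-comm; +-assoc; +-identityʳ; +-cancelˡ-≡; *-suc; *-identityˡ; *-comm; *-assoc; *-monoˡ-≤;
         m+[n∸m]≡n; m+n∸m≡n; ∸-monoˡ-≤; module ≤-Reasoning)
  renaming (_≟_ to _≟ℕ_)
open import Data.Product using (_,_; proj₁; proj₂; ∃-syntax)
open import Data.Sum using (_⊎_; inj₁; inj₂)
import Data.Sum as Sum
open import Data.Vec using ([]; _∷_; lookup; tabulate)
open import Data.Vec.Properties using (lookup∘tabulate; []=⇒lookup; lookup⇒[]=; ≡-dec)
open import Function using (_∘_; Equivalence)
open import Relation.Binary.PropositionalEquality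
  using (_≡_; _≢_; refl; sym; trans; cong; subst; module ≡-Reasoning)
open import Relation.Nullary using (yes; no; contradiction)
open import Relation.Nullary.Decidable using (⌊_⌋; toWitness; fromWitness)

open import Algebra.Properties.CommutativeMonoid.Sum +-0-commutativeMonoid
  using (sum-syntax; ∑-comm; ∑-distrib-+; sum-cong-≗)

module _ where

  private
    variable
      m n : ℕ
      p q : Subset n
      x y z : Fin n

  Empty⇒∣p∣≡0 : ∀ {n} {p : Subset n} → Empty p → ∣ p ∣ ≡ 0
  Empty⇒∣p∣≡0 {n} e = trans (cong ∣_∣ (Empty-unique e)) (∣⊥∣≡0 n)

  1≤∣p∣ : x ∈ p → 1 ≤ ∣ p ∣
  1≤∣p∣ x∈p = ≤-trans (s≤s z≤n) (x∈p⇒∣p-x∣<∣p∣ x∈p)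

  2≤∣p∣ : x ≢ y → x ∈ p → y ∈ p → 2 ≤ ∣ p ∣
  2≤∣p∣ x≢y x∈p y∈p = ≤-trans (s≤s (1≤∣p∣ (x∈p∧x≢y⇒x∈p-y y∈p (x≢y ∘ sym)))) (x∈p⇒∣p-x∣<∣p∣ x∈p)

  3≤∣p∣ : x ≢ y → x ≢ z → y ≢ z → x ∈ p → y ∈ p → z ∈ p → 3 ≤ ∣ p ∣
  3≤∣p∣ x≢y x≢z y≢z x∈p y∈p z∈p =
    ≤-trans (s≤s (2≤∣p∣ y≢z (x∈p∧x≢y⇒x∈p-y y∈p (x≢y ∘ sym)) (x∈p∧x≢y⇒x∈p-y z∈p (x≢z ∘ sym))))
            (x∈p⇒∣p-x∣<∣p∣ x∈p)

  ∣p∣≤1 : (∀ {x y} → x ∈ p → y ∈ p → x ≡ y) → ∣ p ∣ ≤ 1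
  ∣p∣≤1 {p = p} unique with nonempty? p
  ... | no ¬nonempty  = subst (_≤ 1) (sym (Empty⇒∣p∣≡0 ¬nonempty)) z≤n
  ... | yes (x , x∈p) =
    subst (∣ p ∣ ≤_) (∣⁅x⁆∣≡1 x) (p⊆q⇒∣p∣≤∣q∣ λ y∈p → subst (_∈ ⁅ x ⁆) (unique x∈p y∈p) (x∈⁅x⁆ x))

  ⊆⁅x⁆⇒≡⁅x⁆ : p ⊆ ⁅ x ⁆ → x ∈ p → p ≡ ⁅ x ⁆
  ⊆⁅x⁆⇒≡⁅x⁆ {p = p} {x = x} p⊆⁅x⁆ x∈p =
    ⊆-antisym p⊆⁅x⁆ (λ y∈⁅x⁆ → subst (_∈ p) (sym (x∈⁅y⁆⇒x≡y x y∈⁅x⁆)) x∈p)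

  ∣p∣≤1⇒≡⁅x⁆ : x ∈ p → ∣ p ∣ ≤ 1 → p ≡ ⁅ x ⁆
  ∣p∣≤1⇒≡⁅x⁆ {x = x} {p = p} x∈p ∣p∣≤1 = ⊆⁅x⁆⇒≡⁅x⁆ p⊆⁅x⁆ x∈p
    where
    p⊆⁅x⁆ : p ⊆ ⁅ x ⁆
    p⊆⁅x⁆ {y} y∈p with y ≟ᶠ x
    ... | yes refl = x∈⁅x⁆ x
    ... | no y≢x   = contradiction (2≤∣p∣ y≢x y∈p x∈p) (<⇒≱ (s≤s ∣p∣≤1))

  ∣p∣≤2⇒⊆ : ∣ p ∣ ≤ 2 → x ≢ y → x ∈ p → y ∈ p → x ∈ q → y ∈ q → p ⊆ q
  ∣p∣≤2⇒⊆ {x = x} {y = y} ∣p∣≤2 x≢y x∈p y∈p x∈q y∈q {z} z∈p with z ≟ᶠ x | z ≟ᶠ y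
  ... | yes refl | _        = x∈q
  ... | no _     | yes refl = y∈q
  ... | no z≢x   | no z≢y   =
    contradiction (3≤∣p∣ x≢y (z≢x ∘ sym) (z≢y ∘ sym) x∈p y∈p z∈p) (<⇒≱ (s≤s ∣p∣≤2))

  ∈-tabulate⁺ : ∀ {f : Fin n → Bool} → T (f x) → x ∈ tabulate f
  ∈-tabulate⁺ {x = x} {f = f} t =
    lookup⇒[]= x (tabulate f) (trans (lookup∘tabulate f x) (Equivalence.to T-≡ t))

  ∈-tabulate⁻ : ∀ {f : Fin n → Bool} → x ∈ tabulate f → T (f x)
  ∈-tabulate⁻ {x = x} {f = f} x∈ = Equivalence.from T-≡ (trans (sym (lookup∘tabulate f x)) ([]=⇒lookup x∈))

  ∣tabulate∣≤1 : ∀ {f : Fin n → Bool} → (∀ {x y} → T (f x) → T (f y) → x ≡ y) → ∣ tabulate f ∣ ≤ 1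
  ∣tabulate∣≤1 unique = ∣p∣≤1 (λ x∈ y∈ → unique (∈-tabulate⁻ x∈) (∈-tabulate⁻ y∈))

  ∣tabulate-∨∣≤ : ∀ (f g : Fin n → Bool) → ∣ tabulate (λ i → f i ∨ g i) ∣ ≤ ∣ tabulate f ∣ + ∣ tabulate g ∣
  ∣tabulate-∨∣≤ {zero}  f g = z≤n
  ∣tabulate-∨∣≤ {suc n} f g with f zero | g zero | ∣tabulate-∨∣≤ (f ∘ suc) (g ∘ suc)
  ... | true  | true  | ih = s≤s (≤-trans ih (+-monoʳ-≤ _ (n≤1+n _)))
  ... | true  | false | ih = s≤s ih
  ... | false | true  | ih =
    ≤-trans (s≤s ih) (≤-reflexive (sym (+-suc ∣ tabulate (f ∘ suc) ∣ ∣ tabulate (g ∘ suc) ∣)))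
  ... | false | false | ih = ih

  indicator : Bool → ℕ
  indicator true  = 1
  indicator false = 0

  ∣p∣≡∑indicator : ∀ (p : Subset n) → ∣ p ∣ ≡ ∑[ i < n ] indicator (lookup p i)
  ∣p∣≡∑indicator []            = refl
  ∣p∣≡∑indicator (inside ∷ p)  = cong suc (∣p∣≡∑indicator p)
  ∣p∣≡∑indicator (outside ∷ p) = ∣p∣≡∑indicator p

  column : (Fin m → Subset n) → Fin n → Subset m
  column R v = tabulate (λ u → lookup (R u) v)

  ∈-column⁻ : ∀ (R : Fin m → Subset n) {u v} → u ∈ column R v → v ∈ R u
  ∈-column⁻ R {u} {v} u∈ = lookup⇒[]= v (R u) (trans (sym (lookup∘tabulate _ u)) ([]=⇒lookup u∈))

  ∑∣∣≡∑∣column∣ : ∀ (R : Fin m → Subset n) → ∑[ u < m ] ∣ R u ∣ ≡ ∑[ v < n ] ∣ column R v ∣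
  ∑∣∣≡∑∣column∣ {m} {n} R = begin
    ∑[ u < m ] ∣ R u ∣                                ≡⟨ sum-cong-≗ (∣p∣≡∑indicator ∘ R) ⟩
    ∑[ u < m ] ∑[ v < n ] indicator (lookup (R u) v)  ≡⟨ ∑-comm (λ u v → indicator (lookup (R u) v)) ⟩
    ∑[ v < n ] ∑[ u < m ] indicator (lookup (R u) v)  ≡⟨ sum-cong-≗ (sym ∘ ∣column∣≡) ⟩
    ∑[ v < n ] ∣ column R v ∣                         ∎
    where
    open ≡-Reasoning
    ∣column∣≡ : ∀ v → ∣ column R v ∣ ≡ ∑[ u < m ] indicator (lookup (R u) v)
    ∣column∣≡ v = trans (∣p∣≡∑indicator (column R v))
      (sum-cong-≗ (cong indicator ∘ lookup∘tabulate (λ u → lookup (R u) v)))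

  *≤∑ : ∀ {k} (f : Fin n → ℕ) → (∀ i → k ≤ f i) → n * k ≤ ∑[ i < n ] f i
  *≤∑ {zero}  f k≤f = z≤n
  *≤∑ {suc n} f k≤f = +-mono-≤ (k≤f zero) (*≤∑ (f ∘ suc) (k≤f ∘ suc))

  *<∑ : ∀ {k} (f : Fin n → ℕ) (i₀ : Fin n) → (∀ i → k ≤ f i) → k < f i₀ → n * k < ∑[ i < n ] f i
  *<∑ f zero     k≤f k<f = +-mono-<-≤ k<f (*≤∑ (f ∘ suc) (k≤f ∘ suc))
  *<∑ f (suc i₀) k≤f k<f = +-mono-≤-< (k≤f zero) (*<∑ (f ∘ suc) i₀ (k≤f ∘ suc) k<f)

  ∑≤*∣∣ : ∀ k (C : Subset n) (f : Fin n → ℕ) →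
    (∀ {v} → v ∉ C → f v ≡ 0) → (∀ v → f v ≤ k) → ∑[ v < n ] f v ≤ k * ∣ C ∣
  ∑≤*∣∣ k []            f f≡0 f≤k = z≤n
  ∑≤*∣∣ k (inside ∷ C)  f f≡0 f≤k =
    subst (∑[ v < _ ] f v ≤_) (sym (*-suc k ∣ C ∣))
      (+-mono-≤ (f≤k zero) (∑≤*∣∣ k C (f ∘ suc) (λ v∉C → f≡0 (v∉C ∘ drop-there)) (f≤k ∘ suc)))
  ∑≤*∣∣ k (outside ∷ C) f f≡0 f≤k =
    subst (λ x → x + ∑[ v < _ ] f (suc v) ≤ k * ∣ C ∣) (sym (f≡0 λ ()))
      (∑≤*∣∣ k C (f ∘ suc) (λ v∉C → f≡0 (v∉C ∘ drop-there)) (f≤k ∘ suc))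

module IdentifyingCodes {n : ℕ} (N : Fin n → Subset n)
  (∈-N-refl : ∀ u → u ∈ N u) (∈-N-sym : ∀ {u v} → v ∈ N u → u ∈ N v) where

  Dominating : Subset n → Set
  Dominating C = ∀ u → Nonempty (N u ∩ C)

  Separating : Subset n → Set
  Separating C = ∀ u v → u ≢ v → N u ∩ C ≢ N v ∩ C

  ∑∣N∩C∣≤ : ∀ {k} C → (∀ v → ∣ N v ∣ ≤ k) → ∑[ u < n ] ∣ N u ∩ C ∣ ≤ k * ∣ C ∣
  ∑∣N∩C∣≤ {k} C ∣N∣≤k = begin
    ∑[ u < n ] ∣ N u ∩ C ∣      ≡⟨ ∑∣∣≡∑∣column∣ N∩C ⟩
    ∑[ v < n ] ∣ column N∩C v ∣ ≤⟨ ∑≤*∣∣ k C _ column-empty ∣column∣≤k ⟩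
    k * ∣ C ∣                   ∎
    where
    open ≤-Reasoning
    N∩C : Fin n → Subset n
    N∩C u = N u ∩ C
    column-empty : ∀ {v} → v ∉ C → ∣ column N∩C v ∣ ≡ 0
    column-empty v∉C = Empty⇒∣p∣≡0 λ (u , u∈) → v∉C (proj₂ (x∈p∩q⁻ (N u) C (∈-column⁻ N∩C u∈)))
    ∣column∣≤k : ∀ v → ∣ column N∩C v ∣ ≤ k
    ∣column∣≤k v =
      ≤-trans (p⊆q⇒∣p∣≤∣q∣ λ {u} u∈ → ∈-N-sym (proj₁ (x∈p∩q⁻ (N u) C (∈-column⁻ N∩C u∈)))) (∣N∣≤k v)

  singletonCodes : Subset n → Fin n → Subset n
  singletonCodes C u = tabulate (λ c → ⌊ ≡-dec _≟ᵇ_ (N u ∩ C) ⁅ c ⁆ ⌋)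

  ∈-singletonCodes⁺ : ∀ {C u c} → N u ∩ C ≡ ⁅ c ⁆ → c ∈ singletonCodes C u
  ∈-singletonCodes⁺ {C} {u} {c} = ∈-tabulate⁺ ∘ fromWitness {a? = ≡-dec _≟ᵇ_ (N u ∩ C) ⁅ c ⁆}

  ∈-singletonCodes⁻ : ∀ {C u c} → c ∈ singletonCodes C u → N u ∩ C ≡ ⁅ c ⁆
  ∈-singletonCodes⁻ {C} {u} {c} = toWitness {a? = ≡-dec _≟ᵇ_ (N u ∩ C) ⁅ c ⁆} ∘ ∈-tabulate⁻

  ∑∣singletonCodes∣≤∣C∣ : ∀ C → Separating C → ∑[ u < n ] ∣ singletonCodes C u ∣ ≤ ∣ C ∣
  ∑∣singletonCodes∣≤∣C∣ C sep = begin
    ∑[ u < n ] ∣ singletonCodes C u ∣          ≡⟨ ∑∣∣≡∑∣column∣ (singletonCodes C) ⟩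
    ∑[ c < n ] ∣ column (singletonCodes C) c ∣ ≤⟨ ∑≤*∣∣ 1 C _ column-empty (λ c → ∣p∣≤1 unique) ⟩
    1 * ∣ C ∣                                  ≡⟨ *-identityˡ ∣ C ∣ ⟩
    ∣ C ∣                                      ∎
    where
    open ≤-Reasoning
    singleton : ∀ {c u} → u ∈ column (singletonCodes C) c → N u ∩ C ≡ ⁅ c ⁆
    singleton = ∈-singletonCodes⁻ ∘ ∈-column⁻ (singletonCodes C)
    column-empty : ∀ {c} → c ∉ C → ∣ column (singletonCodes C) c ∣ ≡ 0
    column-empty {c} c∉C = Empty⇒∣p∣≡0 λ (u , u∈) →
      c∉C (proj₂ (x∈p∩q⁻ (N u) C (subst (c ∈_) (sym (singleton u∈)) (x∈⁅x⁆ c))))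
    unique : ∀ {c u v} → u ∈ column (singletonCodes C) c → v ∈ column (singletonCodes C) c → u ≡ v
    unique {u = u} {v} u∈ v∈ with u ≟ᶠ v
    ... | yes u≡v = u≡v
    ... | no u≢v  = contradiction (trans (singleton u∈) (sym (singleton v∈))) (sep u v u≢v)

  2≤∣N∩C∣+∣singletonCodes∣ : ∀ C u → Nonempty (N u ∩ C) → 2 ≤ ∣ N u ∩ C ∣ + ∣ singletonCodes C u ∣
  2≤∣N∩C∣+∣singletonCodes∣ C u (c , c∈) with ∣ N u ∩ C ∣ ≤? 1
  ... | yes ≤1 = +-mono-≤ (1≤∣p∣ c∈) (1≤∣p∣ (∈-singletonCodes⁺ (∣p∣≤1⇒≡⁅x⁆ c∈ ≤1)))
  ... | no ≰1  = ≤-trans (≰⇒> ≰1) (m≤m+n _ _)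

  ∣N∩C∣≤2 : ∀ {k} C → Dominating C → Separating C → (∀ v → ∣ N v ∣ ≤ k) →
    (1 + k) * ∣ C ∣ ≤ n * 2 → ∀ u → ∣ N u ∩ C ∣ ≤ 2
  ∣N∩C∣≤2 {k} C dom sep ∣N∣≤k small u₀ with ∣ N u₀ ∩ C ∣ ≤? 2
  ... | yes ≤2 = ≤2
  ... | no ≰2  = contradiction small (<⇒≱ (begin-strict
    n * 2                                                       <⟨ *<∑ score u₀ 2≤score 2<score ⟩
    ∑[ u < n ] score u                                          ≡⟨ ∑-distrib-+ (λ u → ∣ N u ∩ C ∣) _ ⟩
    ∑[ u < n ] ∣ N u ∩ C ∣ + ∑[ u < n ] ∣ singletonCodes C u ∣  ≤⟨ +-mono-≤ (∑∣N∩C∣≤ C ∣N∣≤k)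
                                                                             (∑∣singletonCodes∣≤∣C∣ C sep) ⟩
    k * ∣ C ∣ + ∣ C ∣                                           ≡⟨ +-comm (k * ∣ C ∣) ∣ C ∣ ⟩
    (1 + k) * ∣ C ∣                                             ∎))
    where
    open ≤-Reasoning
    score : Fin n → ℕ
    score u = ∣ N u ∩ C ∣ + ∣ singletonCodes C u ∣
    2≤score : ∀ u → 2 ≤ score u
    2≤score u = 2≤∣N∩C∣+∣singletonCodes∣ C u (dom u)
    2<score : 2 < score u₀
    2<score = ≤-trans (≰⇒> ≰2) (m≤m+n _ _)

  module SmallIdentifyingSets {C : Subset n} (sep : Separating C) (∣N∩C∣≤2 : ∀ u → ∣ N u ∩ C ∣ ≤ 2) where

    ≡-of-shared-codewords : ∀ {u v a b} → a ≢ b → a ∈ C → b ∈ C →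
      a ∈ N u → b ∈ N u → a ∈ N v → b ∈ N v → u ≡ v
    ≡-of-shared-codewords {u} {v} a≢b a∈C b∈C a∈Nu b∈Nu a∈Nv b∈Nv with u ≟ᶠ v
    ... | yes u≡v = u≡v
    ... | no u≢v  = contradiction (⊆-antisym (∣p∣≤2⇒⊆ (∣N∩C∣≤2 u) a≢b a∈Iu b∈Iu a∈Iv b∈Iv)
                                             (∣p∣≤2⇒⊆ (∣N∩C∣≤2 v) a≢b a∈Iv b∈Iv a∈Iu b∈Iu))
                                  (sep u v u≢v)
      where
      a∈Iu = x∈p∩q⁺ (a∈Nu , a∈C)
      b∈Iu = x∈p∩q⁺ (b∈Nu , b∈C)
      a∈Iv = x∈p∩q⁺ (a∈Nv , a∈C)
      b∈Iv = x∈p∩q⁺ (b∈Nv , b∈C)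

    adjacent-codewords-≡ : ∀ {a b} → a ∈ C → b ∈ C → b ∈ N a → a ≡ b
    adjacent-codewords-≡ {a} {b} a∈C b∈C b∈Na with a ≟ᶠ b
    ... | yes a≡b = a≡b
    ... | no a≢b  = ≡-of-shared-codewords a≢b a∈C b∈C (∈-N-refl a) b∈Na (∈-N-sym b∈Na) (∈-N-refl b)

    neighbour-of-codeword-∉ : ∀ {c x} → c ∈ C → x ∈ N c → x ≢ c → x ∉ C
    neighbour-of-codeword-∉ c∈C x∈Nc x≢c x∈C = x≢c (sym (adjacent-codewords-≡ c∈C x∈C x∈Nc))
module Modular (n : ℕ) .{{_ : NonZero n}} where

  infixl 6 _⊕_
  _⊕_ : Fin n → ℕ → Fin n
  u ⊕ k = (toℕ u + k) mod n

  toℕ-⊕ : ∀ u k → toℕ (u ⊕ k) ≡ (toℕ u + k) % n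
  toℕ-⊕ u k = toℕ-fromℕ< (m%n<n (toℕ u + k) n)

  toℕ-⊕⇒⊕ : ∀ u k {v} → (toℕ u + k) % n ≡ toℕ v → u ⊕ k ≡ v
  toℕ-⊕⇒⊕ u k eq = toℕ-injective (trans (toℕ-⊕ u k) eq)

  ⊕⇒toℕ-⊕ : ∀ u k {v} → u ⊕ k ≡ v → (toℕ u + k) % n ≡ toℕ v
  ⊕⇒toℕ-⊕ u k eq = trans (sym (toℕ-⊕ u k)) (cong toℕ eq)

  [m%n+k]%n≡[m+k]%n : ∀ m k → (m % n + k) % n ≡ (m + k) % n
  [m%n+k]%n≡[m+k]%n m k = begin
    (m % n + k) % n           ≡⟨ %-distribˡ-+ (m % n) k n ⟩
    (m % n % n + k % n) % n   ≡⟨ cong (λ x → (x + k % n) % n) (m%n%n≡m%n m n) ⟩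
    (m % n + k % n) % n       ≡⟨ %-distribˡ-+ m k n ⟨
    (m + k) % n               ∎
    where open ≡-Reasoning

  ⊕-assoc : ∀ u a b → u ⊕ a ⊕ b ≡ u ⊕ (a + b)
  ⊕-assoc u a b = toℕ-⊕⇒⊕ (u ⊕ a) b (begin
    (toℕ (u ⊕ a) + b) % n     ≡⟨ cong (λ x → (x + b) % n) (toℕ-⊕ u a) ⟩
    ((toℕ u + a) % n + b) % n ≡⟨ [m%n+k]%n≡[m+k]%n (toℕ u + a) b ⟩
    (toℕ u + a + b) % n       ≡⟨ cong (_% n) (+-assoc (toℕ u) a b) ⟩
    (toℕ u + (a + b)) % n     ≡⟨ toℕ-⊕ u (a + b) ⟨
    toℕ (u ⊕ (a + b))         ∎)
    where open ≡-Reasoning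

  ⊕-⊕ : ∀ u {a b k} → a + b ≡ k → u ⊕ a ⊕ b ≡ u ⊕ k
  ⊕-⊕ u {a} {b} eq = trans (⊕-assoc u a b) (cong (u ⊕_) eq)

  ⊕-multiple : ∀ u {k} → n ∣ k → u ⊕ k ≡ u
  ⊕-multiple u {k} n∣k = toℕ-⊕⇒⊕ u k (trans (%-remove-+ʳ (toℕ u) n∣k) (m<n⇒m%n≡m (toℕ<n u)))

  ⊕-% : ∀ u k → u ⊕ (k % n) ≡ u ⊕ k
  ⊕-% u k = toℕ-injective (trans (toℕ-⊕ u (k % n)) (begin
    (toℕ u + k % n) % n       ≡⟨ cong (λ x → (x + k % n) % n) (m<n⇒m%n≡m (toℕ<n u)) ⟨
    (toℕ u % n + k % n) % n   ≡⟨ %-distribˡ-+ (toℕ u) k n ⟨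
    (toℕ u + k) % n           ≡⟨ toℕ-⊕ u k ⟨
    toℕ (u ⊕ k)               ∎))
    where open ≡-Reasoning

  ⊕-cancelʳ : ∀ {u v} k → u ⊕ k ≡ v ⊕ k → u ≡ v
  ⊕-cancelʳ {u} {v} k eq = trans (sym (undo u)) (trans (cong (_⊕ (n ∸ k % n)) eq) (undo v))
    where
    undo : ∀ w → w ⊕ k ⊕ (n ∸ k % n) ≡ w
    undo w = begin
      w ⊕ k ⊕ (n ∸ k % n)         ≡⟨ cong (_⊕ (n ∸ k % n)) (⊕-% w k) ⟨
      w ⊕ (k % n) ⊕ (n ∸ k % n)   ≡⟨ ⊕-⊕ w (m+[n∸m]≡n (m%n≤n k n)) ⟩
      w ⊕ n                       ≡⟨ ⊕-multiple w ∣-refl ⟩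
      w                           ∎
      where open ≡-Reasoning

  ⊕-≢ : ∀ u {k} → 0 < k → k < n → u ⊕ k ≢ u
  ⊕-≢ u {k} 0<k k<n eq = not-multiple ((toℕ u + k) / n) (+-cancelˡ-≡ (toℕ u) k _ (begin
    toℕ u + k                               ≡⟨ m≡m%n+[m/n]*n (toℕ u + k) n ⟩
    (toℕ u + k) % n + (toℕ u + k) / n * n   ≡⟨ cong (_+ (toℕ u + k) / n * n) (⊕⇒toℕ-⊕ u k eq) ⟩
    toℕ u + (toℕ u + k) / n * n             ∎))
    where
    open ≡-Reasoning
    not-multiple : ∀ q → k ≢ q * n
    not-multiple zero    k≡0   = <⇒≢ 0<k (sym k≡0)
    not-multiple (suc q) k≡qn = <⇒≱ k<n (subst (n ≤_) (sym k≡qn) (m≤m+n n (q * n)))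

module Circulant (n : ℕ) .{{_ : NonZero n}} (ds : List ℕ) where

  open Modular n

  Differ : ℕ → Fin n → Fin n → Set
  Differ k u v = u ⊕ k ≡ v ⊎ v ⊕ k ≡ u

  private
    shiftsTo : ℕ → Fin n → Fin n → Bool
    shiftsTo k u v = ⌊ (toℕ u + k) % n ≟ℕ toℕ v ⌋

    shiftsTo⇒⊕ : ∀ k u v → T (shiftsTo k u v) → u ⊕ k ≡ v
    shiftsTo⇒⊕ k u v = toℕ-⊕⇒⊕ u k ∘ toWitness

    ⊕⇒shiftsTo : ∀ k u v → u ⊕ k ≡ v → T (shiftsTo k u v)
    ⊕⇒shiftsTo k u v = fromWitness ∘ ⊕⇒toℕ-⊕ u k

    same : Fin n → Fin n → Bool
    same u v = ⌊ toℕ u ≟ℕ toℕ v ⌋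

    same-unique : ∀ {u v w} → T (same u v) → T (same u w) → v ≡ w
    same-unique tv tw = toℕ-injective (trans (sym (toWitness tv)) (toWitness tw))

  isDiffNeighbour⇒Differ : ∀ k u v → T (isDiffNeighbour n k u v) → Differ k u v
  isDiffNeighbour⇒Differ k u v =
    Sum.map (shiftsTo⇒⊕ k u v) (shiftsTo⇒⊕ k v u) ∘ Equivalence.to (T-∨ {shiftsTo k u v})

  Differ⇒isDiffNeighbour : ∀ k u v → Differ k u v → T (isDiffNeighbour n k u v)
  Differ⇒isDiffNeighbour k u v =
    Equivalence.from (T-∨ {shiftsTo k u v}) ∘ Sum.map (⊕⇒shiftsTo k u v) (⊕⇒shiftsTo k v u)

  ∈-closedNbhd⁻ : ∀ {u v} → v ∈ closedNbhd n ds u → u ≡ v ⊎ Any (λ k → Differ k u v) ds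
  ∈-closedNbhd⁻ {u} {v} =
    Sum.map (toℕ-injective ∘ toWitness) (Any.map (λ {k} → isDiffNeighbour⇒Differ k u v) ∘ any⁻ _ ds)
    ∘ Equivalence.to (T-∨ {same u v}) ∘ ∈-tabulate⁻

  ∈-closedNbhd⁺ : ∀ {u v} → u ≡ v ⊎ Any (λ k → Differ k u v) ds → v ∈ closedNbhd n ds u
  ∈-closedNbhd⁺ {u} {v} =
    ∈-tabulate⁺ ∘ Equivalence.from (T-∨ {same u v})
    ∘ Sum.map (fromWitness ∘ cong toℕ) (any⁺ _ ∘ Any.map (λ {k} → Differ⇒isDiffNeighbour k u v))

  ∈-closedNbhd-refl : ∀ u → u ∈ closedNbhd n ds u
  ∈-closedNbhd-refl u = ∈-closedNbhd⁺ (inj₁ refl)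

  ∈-closedNbhd-sym : ∀ {u v} → v ∈ closedNbhd n ds u → u ∈ closedNbhd n ds v
  ∈-closedNbhd-sym = ∈-closedNbhd⁺ ∘ Sum.map sym (Any.map Sum.swap) ∘ ∈-closedNbhd⁻

  Differ⇒∈-closedNbhd : ∀ u {v k} → k ∈ₗ ds → Differ k u v → v ∈ closedNbhd n ds u
  Differ⇒∈-closedNbhd u k∈ds differ = ∈-closedNbhd⁺ (inj₂ (Any.map (λ { refl → differ }) k∈ds))

  ∣closedNbhd∣≤ : ∀ u → ∣ closedNbhd n ds u ∣ ≤ 1 + 2 * length ds
  ∣closedNbhd∣≤ u = ≤-trans (∣tabulate-∨∣≤ (same u) _) (+-mono-≤ (∣tabulate∣≤1 same-unique) (∣any∣≤ ds))
    where
    ∣isDiffNeighbour∣≤2 : ∀ k → ∣ tabulate (isDiffNeighbour n k u) ∣ ≤ 2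
    ∣isDiffNeighbour∣≤2 k = ≤-trans (∣tabulate-∨∣≤ (shiftsTo k u) (λ v → shiftsTo k v u))
      (+-mono-≤ (∣tabulate∣≤1 λ {v} {w} tv tw → trans (sym (shiftsTo⇒⊕ k u v tv)) (shiftsTo⇒⊕ k u w tw))
                (∣tabulate∣≤1 λ {v} {w} tv tw →
                  ⊕-cancelʳ k (trans (shiftsTo⇒⊕ k v u tv) (sym (shiftsTo⇒⊕ k w u tw)))))
    ∣any∣≤ : ∀ ks → ∣ tabulate (λ v → any (λ k → isDiffNeighbour n k u v) ks) ∣ ≤ 2 * length ks
    ∣any∣≤ [] = ≤-reflexive (Empty⇒∣p∣≡0 λ (_ , v∈) → ∈-tabulate⁻ {n = n} {f = λ _ → false} v∈)
    ∣any∣≤ (k ∷ ks) = ≤-trans (∣tabulate-∨∣≤ (isDiffNeighbour n k u) _)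
      (≤-trans (+-mono-≤ (∣isDiffNeighbour∣≤2 k) (∣any∣≤ ks)) (≤-reflexive (sym (*-suc 2 (length ks)))))

even-or-suc-even : ∀ m → ∃[ j ] (2 * j ≡ m ⊎ 2 * j ≡ suc m)
even-or-suc-even zero = 0 , inj₁ refl
even-or-suc-even (suc m) with even-or-suc-even m
... | j , inj₁ 2j≡m   = suc j , inj₂ (trans (*-suc 2 j) (cong (2 +_) 2j≡m))
... | j , inj₂ 2j≡1+m = j , inj₁ 2j≡1+m

module ThreeDistances (e r : ℕ) (2≤e : 2 ≤ e) (2≤r : 2 ≤ r) where

  n : ℕ
  n = suc e + r

  ds : List ℕ
  ds = 1 ∷ e ∷ suc e ∷ []

  open Modular n
  open Circulant n ds
  open IdentifyingCodes (closedNbhd n ds) ∈-closedNbhd-refl ∈-closedNbhd-sym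

  private
    N : Fin n → Subset n
    N = closedNbhd n ds

    1∈ds : 1 ∈ₗ ds
    1∈ds = here refl
    e∈ds : e ∈ₗ ds
    e∈ds = there (here refl)
    d∈ds : suc e ∈ₗ ds
    d∈ds = there (there (here refl))

    0<e : 0 < e
    0<e = ≤-trans (s≤s z≤n) 2≤e
    0<r : 0 < r
    0<r = ≤-trans (s≤s z≤n) 2≤r
    1<n : 1 < n
    1<n = s≤s (≤-trans 0<e (m≤m+n e r))
    e<n : e < n
    e<n = s≤s (m≤m+n e r)
    r<n : r < n
    r<n = s≤s (m≤n+m r e)
    d<n : suc e < n
    d<n = subst (_< n) (+-identityʳ (suc e)) (+-monoʳ-< (suc e) 0<r)
    2+e<n : 2 + e < n
    2+e<n = s≤s (subst (2 + e ≤_) (+-comm r e) (+-monoˡ-≤ e 2≤r))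
    1+r<n : 1 + r < n
    1+r<n = s≤s (+-monoˡ-≤ r 0<e)
    2+r<n : 2 + r < n
    2+r<n = s≤s (+-monoˡ-≤ r 2≤e)

  -- Points near c, named by their offset from c, where d = e + 1 and n = d + r;
  -- thus c ⊕ (1 + r) is c − e and c ⊕ (2 + r) is c + 1 − e.
  module Around (c : Fin n) where

    c+1 c+2 c+d c-e c+1+d c+1-e : Fin n
    c+1   = c ⊕ 1
    c+2   = c ⊕ 2
    c+d   = c ⊕ suc e
    c-e   = c ⊕ (1 + r)
    c+1+d = c ⊕ (2 + e)
    c+1-e = c ⊕ (2 + r)

    c+1⊕1≡c+2 : c+1 ⊕ 1 ≡ c+2
    c+1⊕1≡c+2 = ⊕-assoc c 1 1

    c+1⊕e≡c+d : c+1 ⊕ e ≡ c+d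
    c+1⊕e≡c+d = ⊕-assoc c 1 e

    c+1⊕r≡c-e : c+1 ⊕ r ≡ c-e
    c+1⊕r≡c-e = ⊕-assoc c 1 r

    c+1⊕d≡c+1+d : c+1 ⊕ suc e ≡ c+1+d
    c+1⊕d≡c+1+d = ⊕-assoc c 1 (suc e)

    c+d⊕1≡c+1+d : c+d ⊕ 1 ≡ c+1+d
    c+d⊕1≡c+1+d = ⊕-⊕ c (+-comm (suc e) 1)

    c-e⊕1≡c+1-e : c-e ⊕ 1 ≡ c+1-e
    c-e⊕1≡c+1-e = ⊕-⊕ c (cong suc (+-comm r 1))

    c-e⊕e≡c : c-e ⊕ e ≡ c
    c-e⊕e≡c = trans (⊕-⊕ c (cong suc (+-comm r e))) (⊕-multiple c ∣-refl)

    c+1-e⊕e≡c+1 : c+1-e ⊕ e ≡ c+1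
    c+1-e⊕e≡c+1 = trans (⊕-⊕ c (cong (2 +_) (+-comm r e)))
                        (trans (sym (⊕-assoc c 1 n)) (⊕-multiple c+1 ∣-refl))

    c-e⊕d≡c+1 : c-e ⊕ suc e ≡ c+1
    c-e⊕d≡c+1 = trans (⊕-⊕ c (cong suc (trans (+-suc r e) (cong suc (+-comm r e)))))
                      (trans (sym (⊕-assoc c 1 n)) (⊕-multiple c+1 ∣-refl))

    c+1≢c : c+1 ≢ c
    c+1≢c = ⊕-≢ c (s≤s z≤n) 1<n

    c+d≢c : c+d ≢ c
    c+d≢c = ⊕-≢ c (s≤s z≤n) d<n

    c-e≢c : c-e ≢ c
    c-e≢c = ⊕-≢ c (s≤s z≤n) 1+r<n

    c≢c+1+d : c ≢ c+1+d
    c≢c+1+d = ⊕-≢ c (s≤s z≤n) 2+e<n ∘ sym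

    c≢c+1-e : c ≢ c+1-e
    c≢c+1-e = ⊕-≢ c (s≤s z≤n) 2+r<n ∘ sym

    c+d≢c+1 : c+d ≢ c+1
    c+d≢c+1 = subst (_≢ c+1) c+1⊕e≡c+d (⊕-≢ c+1 0<e e<n)

    c-e≢c+1 : c-e ≢ c+1
    c-e≢c+1 = subst (_≢ c+1) c+1⊕r≡c-e (⊕-≢ c+1 0<r r<n)

    c∈N[c+1] : c ∈ N c+1
    c∈N[c+1] = Differ⇒∈-closedNbhd c+1 1∈ds (inj₂ refl)

  module _ {C : Subset n} (sep : Separating C) (∣N∩C∣≤2 : ∀ u → ∣ N u ∩ C ∣ ≤ 2) where

    open SmallIdentifyingSets sep ∣N∩C∣≤2

    module _ {c : Fin n} (c∈C : c ∈ C) where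

      open Around c

      c+1∉C : c+1 ∉ C
      c+1∉C = neighbour-of-codeword-∉ c∈C (Differ⇒∈-closedNbhd c 1∈ds (inj₁ refl)) c+1≢c

      c+d∉C : c+d ∉ C
      c+d∉C = neighbour-of-codeword-∉ c∈C (Differ⇒∈-closedNbhd c d∈ds (inj₁ refl)) c+d≢c

      c-e∉C : c-e ∉ C
      c-e∉C = neighbour-of-codeword-∉ c∈C (Differ⇒∈-closedNbhd c e∈ds (inj₂ c-e⊕e≡c)) c-e≢c

      c+1+d∉C : c+1+d ∉ C
      c+1+d∉C c+1+d∈C = c+d≢c+1 (≡-of-shared-codewords c≢c+1+d c∈C c+1+d∈C
        (Differ⇒∈-closedNbhd c+d d∈ds (inj₂ refl)) (Differ⇒∈-closedNbhd c+d 1∈ds (inj₁ c+d⊕1≡c+1+d))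
        c∈N[c+1] (Differ⇒∈-closedNbhd c+1 d∈ds (inj₁ c+1⊕d≡c+1+d)))

      c+1-e∉C : c+1-e ∉ C
      c+1-e∉C c+1-e∈C = c-e≢c+1 (≡-of-shared-codewords c≢c+1-e c∈C c+1-e∈C
        (Differ⇒∈-closedNbhd c-e e∈ds (inj₁ c-e⊕e≡c)) (Differ⇒∈-closedNbhd c-e 1∈ds (inj₁ c-e⊕1≡c+1-e))
        c∈N[c+1] (Differ⇒∈-closedNbhd c+1 e∈ds (inj₂ c+1-e⊕e≡c+1)))

      N[c]∩C≡⁅c⁆ : N c ∩ C ≡ ⁅ c ⁆
      N[c]∩C≡⁅c⁆ = ⊆⁅x⁆⇒≡⁅x⁆ N[c]∩C⊆⁅c⁆ (x∈p∩q⁺ (∈-closedNbhd-refl c , c∈C))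
        where
        N[c]∩C⊆⁅c⁆ : N c ∩ C ⊆ ⁅ c ⁆
        N[c]∩C⊆⁅c⁆ x∈ with x∈p∩q⁻ (N c) C x∈
        ... | x∈Nc , x∈C = subst (_∈ ⁅ c ⁆) (adjacent-codewords-≡ c∈C x∈C x∈Nc) (x∈⁅x⁆ c)

      N[c+1]∩C≡⁅c⁆ : c+2 ∉ C → N c+1 ∩ C ≡ ⁅ c ⁆
      N[c+1]∩C≡⁅c⁆ c+2∉C = ⊆⁅x⁆⇒≡⁅x⁆ N[c+1]∩C⊆⁅c⁆ (x∈p∩q⁺ (c∈N[c+1] , c∈C))
        where
        ≢-∉C : ∀ {x y} → x ∈ C → y ∉ C → x ≢ y
        ≢-∉C x∈C y∉C x≡y = y∉C (subst (_∈ C) x≡y x∈C)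

        codeword-near-c+1-is-c : ∀ {x} → x ∈ C → x ∈ N c+1 → x ≡ c
        codeword-near-c+1-is-c x∈C x∈N with ∈-closedNbhd⁻ {c+1} x∈N
        ... | inj₁ eq                               = ⊥-elim (≢-∉C x∈C c+1∉C (sym eq))
        ... | inj₂ (here (inj₁ eq))                 = ⊥-elim (≢-∉C x∈C c+2∉C (trans (sym eq) c+1⊕1≡c+2))
        ... | inj₂ (here (inj₂ eq))                 = ⊕-cancelʳ 1 eq
        ... | inj₂ (there (here (inj₁ eq)))         = ⊥-elim (≢-∉C x∈C c+d∉C (trans (sym eq) c+1⊕e≡c+d))
        ... | inj₂ (there (here (inj₂ eq)))         =
          ⊥-elim (≢-∉C x∈C c+1-e∉C (⊕-cancelʳ e (trans eq (sym c+1-e⊕e≡c+1))))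
        ... | inj₂ (there (there (here (inj₁ eq)))) = ⊥-elim (≢-∉C x∈C c+1+d∉C (trans (sym eq) c+1⊕d≡c+1+d))
        ... | inj₂ (there (there (here (inj₂ eq)))) =
          ⊥-elim (≢-∉C x∈C c-e∉C (⊕-cancelʳ (suc e) (trans eq (sym c-e⊕d≡c+1))))

        N[c+1]∩C⊆⁅c⁆ : N c+1 ∩ C ⊆ ⁅ c ⁆
        N[c+1]∩C⊆⁅c⁆ x∈ with x∈p∩q⁻ (N c+1) C x∈
        ... | x∈N , x∈C = subst (_∈ ⁅ c ⁆) (sym (codeword-near-c+1-is-c x∈C x∈N)) (x∈⁅x⁆ c)

      c+2∈C : c+2 ∈ C
      c+2∈C with c+2 ∈? C
      ... | yes c+2∈C = c+2∈C
      ... | no c+2∉C  = ⊥-elim (sep c+1 c c+1≢c (trans (N[c+1]∩C≡⁅c⁆ c+2∉C) (sym N[c]∩C≡⁅c⁆)))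

    ⊕2*-∈ : ∀ {c} j → c ∈ C → c ⊕ 2 * j ∈ C
    ⊕2*-∈ {c} zero    c∈C = subst (_∈ C) (sym (⊕-multiple c (n ∣0))) c∈C
    ⊕2*-∈ {c} (suc j) c∈C =
      subst (_∈ C) (⊕-⊕ c (trans (+-comm (2 * j) 2) (sym (*-suc 2 j)))) (c+2∈C (⊕2*-∈ j c∈C))

    no-codewords : ∀ c → c ∉ C
    no-codewords c c∈C with even-or-suc-even e
    ... | j , inj₁ 2j≡e =
      neighbour-of-codeword-∉ c∈C (Differ⇒∈-closedNbhd c e∈ds (inj₁ refl)) (⊕-≢ c 0<e e<n)
        (subst (λ k → c ⊕ k ∈ C) 2j≡e (⊕2*-∈ j c∈C))
    ... | j , inj₂ 2j≡d = c+d∉C c∈C (subst (λ k → c ⊕ k ∈ C) 2j≡d (⊕2*-∈ j c∈C))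

  n<4∣C∣ : (C : Subset n) → IsIdentifyingCode n ds C → n < 4 * ∣ C ∣
  n<4∣C∣ C ((c , c∈C) , dominating , separating) with 4 * ∣ C ∣ ≤? n
  ... | no 4∣C∣≰n  = ≰⇒> 4∣C∣≰n
  ... | yes 4∣C∣≤n =
    ⊥-elim (no-codewords separating (∣N∩C∣≤2 C dominating separating ∣closedNbhd∣≤ 8∣C∣≤n*2) c c∈C)
    where
    8∣C∣≤n*2 : 8 * ∣ C ∣ ≤ n * 2
    8∣C∣≤n*2 = subst (_≤ n * 2) (trans (*-comm (4 * ∣ C ∣) 2) (sym (*-assoc 2 4 ∣ C ∣))) (*-monoˡ-≤ 2 4∣C∣≤n)

corollary4 : (n d : ℕ) → .{{_ : NonZero n}} → 4 ≤ d → 2 * d ≤ n →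
    (C : Subset n) → IsIdentifyingCode n (1 ∷ (d ∸ 1) ∷ d ∷ []) C →
    n < 4 * ∣ C ∣
corollary4 n (suc e) (s≤s 3≤e) 2d≤n C ic with n ∸ suc e | m+[n∸m]≡n d≤n | 2≤n∸d
  where
  d≤n : suc e ≤ n
  d≤n = ≤-trans (m≤m+n (suc e) (suc e + 0)) 2d≤n
  2≤n∸d : 2 ≤ n ∸ suc e
  2≤n∸d = begin
    2                             ≤⟨ s≤s (≤-trans (s≤s z≤n) 3≤e) ⟩
    suc e                         ≤⟨ m≤m+n (suc e) 0 ⟩
    suc e + 0                     ≡⟨ m+n∸m≡n (suc e) (suc e + 0) ⟨
    suc e + (suc e + 0) ∸ suc e   ≤⟨ ∸-monoˡ-≤ (suc e) 2d≤n ⟩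
    n ∸ suc e                     ∎
    where open ≤-Reasoning
... | r | refl | 2≤r = ThreeDistances.n<4∣C∣ e r (≤-trans (s≤s (s≤s z≤n)) 3≤e) 2≤r C ic
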